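{- Let $\alpha$ and $\beta$ be nonzero ordinals of finite degree. Then $\mathrm{D}(\alpha+\beta)\cong\mathrm{D}(\alpha)+\mathrm{D}(\beta)$ in each of the following cases: (1) $\alpha$ is a limit ordinal; or (2) $\alpha$ is a successor ordinal and $\deg(\beta)\ge 2$. In all other cases, $\mathrm{D}(\alpha+\beta)+1\cong\mathrm{D}(\alpha)+\mathrm{D}(\beta)$.
   Context: For a linear order $L$, $x\sim_F y$ iff only finitely many points lie between $x$ and $y$; $L/\!\sim_F$ is the ordered set of classes. $\mathrm{D}(\alpha)$ is the ordinal isomorphic to $\alpha/\!\sim_F$. The degree of an ordinal of finite degree is the largest exponent $n$ in its Cantor normal form $a_n\omega^n+\cdots+a_0$ ($a_n\ne0$). -}

module Defs where

open import Level using (0ℓ)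
open import Data.Nat using (ℕ; zero; suc; _<_; _≤_; _∸_; NonZero)
open import Data.List using (List; []; _∷_; length)
open import Data.List.Relation.Unary.Any using (Any)
open import Data.Product using (Σ; ∃; _×_; proj₁)
open import Data.Sum using (_⊎_; inj₁; inj₂)
open import Data.Unit using (⊤; tt)
open import Data.Empty using (⊥)
open import Relation.Nullary using (¬_)
open import Relation.Binary.PropositionalEquality using (_≡_)

-- Ordinals of finite degree (i.e. ordinals < ω^ω), via Cantor normal form
-- a_n ω^n + ... + a_0, stored big-endian as [a_n, ..., a_0] with a_n ≠ 0.
-- The ordinal 0 is the empty list.

Normal : List ℕ → Set
Normal []      = ⊤
Normal (a ∷ _) = NonZero a

CNF : Set
CNF = Σ (List ℕ) Normal

data Lex : List ℕ → List ℕ → Set where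
  here  : ∀ {a b xs ys} → a < b → Lex (a ∷ xs) (b ∷ ys)
  there : ∀ {a xs ys} → Lex xs ys → Lex (a ∷ xs) (a ∷ ys)

_<ᶜ_ : List ℕ → List ℕ → Set
x <ᶜ y = length x < length y ⊎ (length x ≡ length y × Lex x y)

Nonzero : CNF → Set
Nonzero α = ¬ (proj₁ α ≡ [])

deg : CNF → ℕ
deg α = length (proj₁ α) ∸ 1

record Chain : Set₁ where
  field
    Carrier : Set
    Eq      : Carrier → Carrier → Set
    Lt      : Carrier → Carrier → Set

open Chain public

Pt : CNF → Set
Pt α = Σ CNF (λ x → proj₁ x <ᶜ proj₁ α)

ordChain : CNF → Chain
ordChain α = record
  { Carrier = Pt α
  ; Eq      = λ x y → proj₁ (proj₁ x) ≡ proj₁ (proj₁ y)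
  ; Lt      = λ x y → proj₁ (proj₁ x) <ᶜ proj₁ (proj₁ y)
  }

_⊕_ : Chain → Chain → Chain
L ⊕ M = record
  { Carrier = Carrier L ⊎ Carrier M
  ; Eq      = eq
  ; Lt      = lt
  }
  where
  eq : Carrier L ⊎ Carrier M → Carrier L ⊎ Carrier M → Set
  eq (inj₁ x) (inj₁ y) = Eq L x y
  eq (inj₂ x) (inj₂ y) = Eq M x y
  eq _        _        = ⊥
  lt : Carrier L ⊎ Carrier M → Carrier L ⊎ Carrier M → Set
  lt (inj₁ x) (inj₁ y) = Lt L x y
  lt (inj₁ x) (inj₂ y) = ⊤
  lt (inj₂ x) (inj₁ y) = ⊥
  lt (inj₂ x) (inj₂ y) = Lt M x y

One : Chain
One = record { Carrier = ⊤ ; Eq = λ _ _ → ⊤ ; Lt = λ _ _ → ⊥ }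

Between : (L : Chain) → Carrier L → Carrier L → Carrier L → Set
Between L x z y = (Lt L x z × Lt L z y) ⊎ (Lt L y z × Lt L z x)

_∼F_within_ : {L : Chain} → Carrier L → Carrier L → Set
_∼F_within_ {L} x y =
  ∃ λ (ps : List (Carrier L)) →
    ∀ z → Between L x z y → Any (λ w → Eq L z w) ps

FinEq : (L : Chain) → Carrier L → Carrier L → Set
FinEq L x y = _∼F_within_ {L} x y

Cond : Chain → Chain
Cond L = record
  { Carrier = Carrier L
  ; Eq      = FinEq L
  ; Lt      = λ x y → Lt L x y × ¬ FinEq L x y
  }

record _≅_ (A B : Chain) : Set where
  field
    to     : Carrier A → Carrier B
    from   : Carrier B → Carrier A
    to-≈   : ∀ {x y} → Eq A x y → Eq B (to x) (to y)
    to-<   : ∀ {x y} → Lt A x y → Lt B (to x) (to y)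
    from-≈ : ∀ {x y} → Eq B x y → Eq A (from x) (from y)
    from-< : ∀ {x y} → Lt B x y → Lt A (from x) (from y)
    from∘to : ∀ x → Eq A (from (to x)) x
    to∘from : ∀ y → Eq B (to (from y)) y

D : CNF → Chain
D α = Cond (ordChain α)

-- D(α + β), with α + β presented as the ordered sum of α and β
D+ : CNF → CNF → Chain
D+ α β = Cond (ordChain α ⊕ ordChain β)

IsSucc : CNF → Set
IsSucc α = ∃ λ (p : Pt α) → ∀ (q : Pt α) → ¬ (Lt (ordChain α) p q)

IsLimit : CNF → Set
IsLimit α = Nonzero α × ¬ IsSucc α

{-# OPTIONS --safe #-}
module Submission where

-- Write an ordinal x < ω^ω as x = ω·h + k with k finite (h = divω x, k = modω x). Two points of
-- an ordinal are ∼F-equivalent iff they have the same h, so D(γ) is keyed by h. In α + β the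
-- classes are those of α followed by those of β, except that when α = ω·a + l is a successor
-- (l > 0) the last class of α, the finite block ω·a + [0, l), merges with the first class [0, ω)
-- of β. So D(α + β) ≅ D(α) + D(β) when α is a limit, and D(α + β) ≅ D(α) + D(β)⁻ when α is a
-- successor, where D(β)⁻ is D(β) without its first point. Keying D(β) by 1 + h instead of h
-- matches it with D(β)⁻: if deg β ≥ 2, D(β) begins with ω points and h ↦ 1 + h is onto D(β)⁻;
-- if deg β < 2, D(β) is finite and D(β)⁻ + 1 ≅ D(β).

open import Defs
open import Data.Nat using (ℕ; zero; suc; z≤n; s≤s; pred; _∸_; _≤_; _<_; >-nonZero)
open import Data.Nat.Properties
open import Data.List as List using (List; []; _∷_; _∷ʳ_; _++_; length; mapMaybe)
open import Data.List.Extrema.Nat using (max; v≤max⁺; ⊥≤max)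
open import Data.List.Relation.Unary.Any using (Any)
import Data.List.Relation.Unary.Any as Any
import Data.List.Relation.Unary.Any.Properties as Any
open import Data.Maybe.Relation.Unary.Any as MaybeAny using (just)
open import Data.Product using (Σ; ∃; _×_; _,_; proj₁; proj₂)
open import Data.Product.Relation.Binary.Lex.Strict using (×-Lex)
open import Data.Sum as Sum using (_⊎_; inj₁; inj₂; [_,_]′; isInj₁; isInj₂)
open import Data.Sum.Properties using (inj₁-injective; inj₂-injective)
open import Data.Sum.Relation.Binary.LeftOrder
  using (_⊎-<_; ₁∼₂; ₁∼₁; ₂∼₂; ⊎-<-asymmetric)
open import Data.Unit using (tt)
open import Data.Empty using (⊥; ⊥-elim)
open import Function using (_∘_; id)
open import Relation.Nullary using (¬_)
open import Relation.Binary.Definitions using (Asymmetric; tri<; tri≈; tri>)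
open import Relation.Binary.PropositionalEquality

private variable
  a b k k′ : ℕ
  h h′ x y z : List ℕ

Trichotomy : {K : Set} → (K → K → Set) → Set
Trichotomy _<_ = ∀ a b → a < b ⊎ a ≡ b ⊎ b < a

⊎-<-trichotomy : {K₁ K₂ : Set} {_<₁_ : K₁ → K₁ → Set} {_<₂_ : K₂ → K₂ → Set} →
  Trichotomy _<₁_ → Trichotomy _<₂_ → Trichotomy (_<₁_ ⊎-< _<₂_)
⊎-<-trichotomy tri₁ tri₂ (inj₁ a) (inj₁ b) = Sum.map ₁∼₁ (Sum.map (cong inj₁) ₁∼₁) (tri₁ a b)
⊎-<-trichotomy tri₁ tri₂ (inj₁ _) (inj₂ _) = inj₁ ₁∼₂
⊎-<-trichotomy tri₁ tri₂ (inj₂ _) (inj₁ _) = inj₂ (inj₂ ₁∼₂)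
⊎-<-trichotomy tri₁ tri₂ (inj₂ a) (inj₂ b) = Sum.map ₂∼₂ (Sum.map (cong inj₂) ₂∼₂) (tri₂ a b)

-- The order on Cantor normal forms

Lex-irrefl : ¬ Lex x x
Lex-irrefl (here a<a) = <-irrefl refl a<a
Lex-irrefl (there l)  = Lex-irrefl l

Lex-trans : Lex x y → Lex y z → Lex x z
Lex-trans (here p)  (here q)  = here (<-trans p q)
Lex-trans (here p)  (there _) = here p
Lex-trans (there _) (here q)  = here q
Lex-trans (there p) (there q) = there (Lex-trans p q)

Lex-trichotomy : ∀ x y → length x ≡ length y → Lex x y ⊎ x ≡ y ⊎ Lex y x
Lex-trichotomy []      []      _ = inj₂ (inj₁ refl)
Lex-trichotomy (a ∷ x) (b ∷ y) e with <-cmp a b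
... | tri< a<b _ _ = inj₁ (here a<b)
... | tri> _ _ b<a = inj₂ (inj₂ (here b<a))
... | tri≈ _ refl _ with Lex-trichotomy x y (suc-injective e)
...   | inj₁ l          = inj₁ (there l)
...   | inj₂ (inj₁ refl) = inj₂ (inj₁ refl)
...   | inj₂ (inj₂ l)   = inj₂ (inj₂ (there l))

<ᶜ-irrefl : ¬ (x <ᶜ x)
<ᶜ-irrefl (inj₁ p)       = <-irrefl refl p
<ᶜ-irrefl (inj₂ (_ , l)) = Lex-irrefl l

<ᶜ-trans : x <ᶜ y → y <ᶜ z → x <ᶜ z
<ᶜ-trans (inj₁ p)       (inj₁ q)        = inj₁ (<-trans p q)
<ᶜ-trans (inj₁ p)       (inj₂ (e , _))  = inj₁ (<-≤-trans p (≤-reflexive e))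
<ᶜ-trans (inj₂ (e , _)) (inj₁ q)        = inj₁ (≤-<-trans (≤-reflexive e) q)
<ᶜ-trans (inj₂ (e , p)) (inj₂ (e′ , q)) = inj₂ (trans e e′ , Lex-trans p q)

<ᶜ-asym : x <ᶜ y → ¬ (y <ᶜ x)
<ᶜ-asym p q = <ᶜ-irrefl (<ᶜ-trans p q)

<ᶜ-trichotomy : Trichotomy _<ᶜ_
<ᶜ-trichotomy x y with <-cmp (length x) (length y)
... | tri< p _ _ = inj₁ (inj₁ p)
... | tri> _ _ p = inj₂ (inj₂ (inj₁ p))
... | tri≈ _ e _ with Lex-trichotomy x y e
...   | inj₁ l          = inj₁ (inj₂ (e , l))
...   | inj₂ (inj₁ x≡y) = inj₂ (inj₁ x≡y)
...   | inj₂ (inj₂ l)   = inj₂ (inj₂ (inj₂ (sym e , l)))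

<ᶜ⇒length≤ : x <ᶜ y → length x ≤ length y
<ᶜ⇒length≤ (inj₁ p)       = <⇒≤ p
<ᶜ⇒length≤ (inj₂ (e , _)) = ≤-reflexive e

≮ᶜ[] : ¬ (x <ᶜ [])
≮ᶜ[] (inj₁ ())
≮ᶜ[] {[]}    (inj₂ (_ , ()))
≮ᶜ[] {_ ∷ _} (inj₂ (() , _))

[]<ᶜ∷ : [] <ᶜ (a ∷ h)
[]<ᶜ∷ = inj₁ (s≤s z≤n)

_≤ᶜ_ : List ℕ → List ℕ → Set
x ≤ᶜ y = x <ᶜ y ⊎ x ≡ y

≤ᶜ-<ᶜ-trans : x ≤ᶜ y → y <ᶜ z → x <ᶜ z
≤ᶜ-<ᶜ-trans (inj₁ p)    q = <ᶜ-trans p q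
≤ᶜ-<ᶜ-trans (inj₂ refl) q = q

<ᶜ-≤ᶜ-trans : x <ᶜ y → y ≤ᶜ z → x <ᶜ z
<ᶜ-≤ᶜ-trans p (inj₁ q)    = <ᶜ-trans p q
<ᶜ-≤ᶜ-trans p (inj₂ refl) = p

-- Division by ω

fromℕ : ℕ → List ℕ
fromℕ zero    = []
fromℕ (suc n) = suc n ∷ []

infix 30 ω*_+_

ω*_+_ : List ℕ → ℕ → List ℕ
ω* []      + k = fromℕ k
ω* (a ∷ h) + k = (a ∷ h) ∷ʳ k

divω : List ℕ → List ℕ
divω []          = []
divω (_ ∷ [])    = []
divω (a ∷ b ∷ x) = a ∷ divω (b ∷ x)

modω : List ℕ → ℕ
modω []          = 0
modω (a ∷ [])    = a
modω (_ ∷ b ∷ x) = modω (b ∷ x)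

divω-∷ʳ : ∀ h k → divω (h ∷ʳ k) ≡ h
divω-∷ʳ []          _ = refl
divω-∷ʳ (_ ∷ [])    _ = refl
divω-∷ʳ (a ∷ b ∷ h) k = cong (a ∷_) (divω-∷ʳ (b ∷ h) k)

modω-∷ʳ : ∀ h k → modω (h ∷ʳ k) ≡ k
modω-∷ʳ []          _ = refl
modω-∷ʳ (_ ∷ [])    _ = refl
modω-∷ʳ (_ ∷ b ∷ h) k = modω-∷ʳ (b ∷ h) k

divω-ω*+ : ∀ h k → divω (ω* h + k) ≡ h
divω-ω*+ []      zero    = refl
divω-ω*+ []      (suc _) = refl
divω-ω*+ (a ∷ h) k       = divω-∷ʳ (a ∷ h) k

modω-ω*+ : ∀ h k → modω (ω* h + k) ≡ k
modω-ω*+ []      zero    = refl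
modω-ω*+ []      (suc _) = refl
modω-ω*+ (a ∷ h) k       = modω-∷ʳ (a ∷ h) k

∷ʳ-divω-modω : ∀ a x → divω (a ∷ x) ∷ʳ modω (a ∷ x) ≡ a ∷ x
∷ʳ-divω-modω _ []      = refl
∷ʳ-divω-modω a (b ∷ x) = cong (a ∷_) (∷ʳ-divω-modω b x)

ω*divω+modω : ∀ x → Normal x → ω* divω x + modω x ≡ x
ω*divω+modω []             _ = refl
ω*divω+modω (suc _ ∷ [])   _ = refl
ω*divω+modω (a ∷ b ∷ x)    _ = cong (a ∷_) (∷ʳ-divω-modω b x)

Normal-divω : ∀ x → Normal x → Normal (divω x)
Normal-divω []          _  = tt
Normal-divω (_ ∷ [])    _  = tt
Normal-divω (_ ∷ _ ∷ _) nz = nz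

Normal-ω*+ : ∀ h k → Normal h → Normal (ω* h + k)
Normal-ω*+ []      zero    _  = tt
Normal-ω*+ []      (suc _) _  = _
Normal-ω*+ (_ ∷ _) _       nz = nz

length-∷ʳ : ∀ (h : List ℕ) k → length (h ∷ʳ k) ≡ suc (length h)
length-∷ʳ []      _ = refl
length-∷ʳ (_ ∷ h) k = cong suc (length-∷ʳ h k)

length-divω : ∀ x → length (divω x) ≡ length x ∸ 1
length-divω []          = refl
length-divω (_ ∷ [])    = refl
length-divω (_ ∷ b ∷ x) = cong suc (length-divω (b ∷ x))

length-fromℕ : ∀ k → length (fromℕ k) ≤ 1
length-fromℕ zero    = z≤n
length-fromℕ (suc _) = s≤s z≤n

length-ω*∷+ : ∀ a h k → length (ω* (a ∷ h) + k) ≡ suc (suc (length h))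
length-ω*∷+ a h k = length-∷ʳ (a ∷ h) k

fromℕ<ᶜω*∷+ : ∀ n a h k → fromℕ n <ᶜ ω* (a ∷ h) + k
fromℕ<ᶜω*∷+ n a h k = inj₁ (begin-strict
  length (fromℕ n)            <⟨ s≤s (length-fromℕ n) ⟩
  2                           ≤⟨ s≤s (s≤s z≤n) ⟩
  suc (suc (length h))        ≡⟨ length-ω*∷+ a h k ⟨
  length (ω* (a ∷ h) + k)     ∎)
  where open ≤-Reasoning

fromℕ-<ᶜ : a < b → fromℕ a <ᶜ fromℕ b
fromℕ-<ᶜ {zero}  {suc _} _   = []<ᶜ∷
fromℕ-<ᶜ {suc _} {suc _} a<b = inj₂ (refl , here a<b)

fromℕ-<ᶜ⁻ : fromℕ a <ᶜ fromℕ b → a < b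
fromℕ-<ᶜ⁻ {zero}  {zero}  p                    = ⊥-elim (<ᶜ-irrefl p)
fromℕ-<ᶜ⁻ {zero}  {suc _} _                    = s≤s z≤n
fromℕ-<ᶜ⁻ {suc _} {zero}  p                    = ⊥-elim (≮ᶜ[] p)
fromℕ-<ᶜ⁻ {suc _} {suc _} (inj₁ (s≤s ()))
fromℕ-<ᶜ⁻ {suc _} {suc _} (inj₂ (_ , here p)) = p

Lex-∷ʳ⁺ : Lex h h′ ⊎ (h ≡ h′ × k < k′) → Lex (h ∷ʳ k) (h′ ∷ʳ k′)
Lex-∷ʳ⁺ (inj₁ (here p))           = here p
Lex-∷ʳ⁺ (inj₁ (there l))          = there (Lex-∷ʳ⁺ (inj₁ l))
Lex-∷ʳ⁺ {[]}    (inj₂ (refl , p)) = here p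
Lex-∷ʳ⁺ {_ ∷ _} (inj₂ (refl , p)) = there (Lex-∷ʳ⁺ (inj₂ (refl , p)))

Lex-∷ʳ⁻ : ∀ h h′ → length h ≡ length h′ → Lex (h ∷ʳ k) (h′ ∷ʳ k′) →
          Lex h h′ ⊎ (h ≡ h′ × k < k′)
Lex-∷ʳ⁻ []      []       _ (here p)  = inj₂ (refl , p)
Lex-∷ʳ⁻ (_ ∷ _) (_ ∷ _)  _ (here p)  = inj₁ (here p)
Lex-∷ʳ⁻ (a ∷ h) (.a ∷ h′) e (there l) with Lex-∷ʳ⁻ h h′ (suc-injective e) l
... | inj₁ l′         = inj₁ (there l′)
... | inj₂ (refl , p) = inj₂ (refl , p)

_<ₗₑₓ_ : List ℕ × ℕ → List ℕ × ℕ → Set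
_<ₗₑₓ_ = ×-Lex _≡_ _<ᶜ_ _<_

∷ʳ-<ᶜ⁺ : ∀ {h k h′ k′} → (h , k) <ₗₑₓ (h′ , k′) → (h ∷ʳ k) <ᶜ (h′ ∷ʳ k′)
∷ʳ-<ᶜ⁺ {h} {k} {h′} {k′} (inj₁ (inj₁ p)) =
  inj₁ (subst₂ _<_ (sym (length-∷ʳ h k)) (sym (length-∷ʳ h′ k′)) (s≤s p))
∷ʳ-<ᶜ⁺ {h} {k} {h′} {k′} (inj₁ (inj₂ (e , l))) =
  inj₂ ( trans (length-∷ʳ h k) (trans (cong suc e) (sym (length-∷ʳ h′ k′)))
       , Lex-∷ʳ⁺ (inj₁ l))
∷ʳ-<ᶜ⁺ {h} {k} {_} {k′} (inj₂ (refl , p)) =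
  inj₂ (trans (length-∷ʳ h k) (sym (length-∷ʳ h k′)) , Lex-∷ʳ⁺ (inj₂ (refl , p)))

∷ʳ-<ᶜ⁻ : ∀ {k k′} h h′ → (h ∷ʳ k) <ᶜ (h′ ∷ʳ k′) → (h , k) <ₗₑₓ (h′ , k′)
∷ʳ-<ᶜ⁻ {k} {k′} h h′ (inj₁ p) =
  inj₁ (inj₁ (≤-pred (subst₂ _<_ (length-∷ʳ h k) (length-∷ʳ h′ k′) p)))
∷ʳ-<ᶜ⁻ {k} {k′} h h′ (inj₂ (e , l)) =
  [ (λ l′ → inj₁ (inj₂ (e′ , l′))) , inj₂ ]′ (Lex-∷ʳ⁻ h h′ e′ l)
  where
  e′ : length h ≡ length h′
  e′ = suc-injective (trans (sym (length-∷ʳ h k)) (trans e (length-∷ʳ h′ k′)))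

ω*+-<ᶜ⁺ : ∀ {k k′} h h′ → (h , k) <ₗₑₓ (h′ , k′) → ω* h + k <ᶜ ω* h′ + k′
ω*+-<ᶜ⁺         []      []       (inj₁ p)       = ⊥-elim (<ᶜ-irrefl p)
ω*+-<ᶜ⁺         []      []       (inj₂ (_ , p)) = fromℕ-<ᶜ p
ω*+-<ᶜ⁺ {k} {k′} []      (b ∷ h′) _              = fromℕ<ᶜω*∷+ k b h′ k′
ω*+-<ᶜ⁺         (_ ∷ _) []       (inj₁ p)       = ⊥-elim (≮ᶜ[] p)
ω*+-<ᶜ⁺         (_ ∷ _) (_ ∷ _)  p              = ∷ʳ-<ᶜ⁺ p

ω*+-<ᶜ⁻ : ∀ {k k′} h h′ → ω* h + k <ᶜ ω* h′ + k′ → (h , k) <ₗₑₓ (h′ , k′)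
ω*+-<ᶜ⁻         []      []       p = inj₂ (refl , fromℕ-<ᶜ⁻ p)
ω*+-<ᶜ⁻         []      (_ ∷ _)  _ = inj₁ []<ᶜ∷
ω*+-<ᶜ⁻ {k} {k′} (a ∷ h) []       p = ⊥-elim (<ᶜ-asym p (fromℕ<ᶜω*∷+ k′ a h k))
ω*+-<ᶜ⁻         (a ∷ h) (b ∷ h′) p = ∷ʳ-<ᶜ⁻ (a ∷ h) (b ∷ h′) p

divModω : List ℕ → List ℕ × ℕ
divModω x = divω x , modω x

<ᶜ⇒<ₗₑₓ : Normal x → Normal y → x <ᶜ y → divModω x <ₗₑₓ divModω y
<ᶜ⇒<ₗₑₓ {x} {y} nx ny x<y = ω*+-<ᶜ⁻ (divω x) (divω y)
  (subst₂ _<ᶜ_ (sym (ω*divω+modω x nx)) (sym (ω*divω+modω y ny)) x<y)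

<ₗₑₓ⇒<ᶜ : Normal x → Normal y → divModω x <ₗₑₓ divModω y → x <ᶜ y
<ₗₑₓ⇒<ᶜ {x} {y} nx ny p =
  subst₂ _<ᶜ_ (ω*divω+modω x nx) (ω*divω+modω y ny) (ω*+-<ᶜ⁺ (divω x) (divω y) p)

divω-mono : Normal x → Normal y → x <ᶜ y → divω x ≤ᶜ divω y
divω-mono nx ny x<y = [ inj₁ , inj₂ ∘ proj₁ ]′ (<ᶜ⇒<ₗₑₓ nx ny x<y)

divω-<ᶜ⁻ : Normal x → Normal y → divω x <ᶜ divω y → x <ᶜ y
divω-<ᶜ⁻ nx ny p = <ₗₑₓ⇒<ᶜ nx ny (inj₁ p)

_≺-in-class_ : List ℕ → List ℕ → Set
x ≺-in-class y = divω x ≡ divω y × modω x < modω y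

same-divω-<ᶜ : Normal x → Normal y → x <ᶜ y → ¬ (divω x <ᶜ divω y) → x ≺-in-class y
same-divω-<ᶜ nx ny x<y ¬p = [ ⊥-elim ∘ ¬p , id ]′ (<ᶜ⇒<ₗₑₓ nx ny x<y)

ω*divω+<ᶜ : Normal x → k < modω x → ω* divω x + k <ᶜ x
ω*divω+<ᶜ {x} {k} nx p =
  subst (ω* divω x + k <ᶜ_) (ω*divω+modω x nx) (ω*+-<ᶜ⁺ (divω x) (divω x) (inj₂ (refl , p)))

<ᶜω*divω+ : Normal x → modω x < k → x <ᶜ ω* divω x + k
<ᶜω*divω+ {x} {k} nx p =
  subst (_<ᶜ ω* divω x + k) (ω*divω+modω x nx) (ω*+-<ᶜ⁺ (divω x) (divω x) (inj₂ (refl , p)))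

ω*+<ᶜ : Normal y → h <ᶜ divω y → ω* h + k <ᶜ y
ω*+<ᶜ {y} {h} {k} ny p = subst (ω* h + k <ᶜ_) (ω*divω+modω y ny) (ω*+-<ᶜ⁺ h (divω y) (inj₁ p))

between-same-divω : Normal x → Normal z → Normal y →
  x <ᶜ z → z <ᶜ y → divω x ≡ divω y → z ≺-in-class y
between-same-divω nx nz ny x<z z<y x~y = same-divω-<ᶜ nz ny z<y
  (λ z<y → <ᶜ-irrefl (subst (_<ᶜ divω _) x~y (≤ᶜ-<ᶜ-trans (divω-mono nx nz x<z) z<y)))

1+ : List ℕ → List ℕ
1+ []          = 1 ∷ []
1+ (c ∷ [])    = suc c ∷ []
1+ (a ∷ b ∷ x) = a ∷ b ∷ x

1+-fromℕ : ∀ n → 1+ (fromℕ n) ≡ fromℕ (suc n)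
1+-fromℕ zero    = refl
1+-fromℕ (suc _) = refl

1+-mono : Normal x → Normal y → x <ᶜ y → 1+ x <ᶜ 1+ y
1+-mono {[]}        {[]}           _ _ p                     = ⊥-elim (<ᶜ-irrefl p)
1+-mono {[]}        {suc _ ∷ []}   _ _ _                     = inj₂ (refl , here (s≤s (s≤s z≤n)))
1+-mono {[]}        {_ ∷ _ ∷ _}    _ _ _                     = inj₁ (s≤s (s≤s z≤n))
1+-mono {_ ∷ _}     {[]}           _ _ p                     = ⊥-elim (≮ᶜ[] p)
1+-mono {_ ∷ []}    {_ ∷ []}       _ _ (inj₁ (s≤s ()))
1+-mono {_ ∷ []}    {_ ∷ []}       _ _ (inj₂ (_ , here c<d)) = inj₂ (refl , here (s≤s c<d))
1+-mono {_ ∷ []}    {_ ∷ _ ∷ _}    _ _ _                     = inj₁ (s≤s (s≤s z≤n))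
1+-mono {_ ∷ _ ∷ _} {_ ∷ []}       _ _ p with <ᶜ⇒length≤ p
... | s≤s ()
1+-mono {_ ∷ _ ∷ _} {_ ∷ _ ∷ _}    _ _ p                     = p

1+-divω-ω*fromℕ+ : ∀ n k → 1+ (divω (ω* fromℕ n + k)) ≡ fromℕ (suc n)
1+-divω-ω*fromℕ+ n k = trans (cong 1+ (divω-ω*+ (fromℕ n) k)) (1+-fromℕ n)

length-ω*fromℕ+ : ∀ n k → length (ω* fromℕ n + k) ≤ 2
length-ω*fromℕ+ zero    k = ≤-trans (length-fromℕ k) (s≤s z≤n)
length-ω*fromℕ+ (suc n) k = ≤-reflexive (length-ω*∷+ (suc n) [] k)

ω*fromℕ+<ᶜ : ∀ {n k} → 2 ≤ length x ∸ 1 → ω* fromℕ n + k <ᶜ x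
ω*fromℕ+<ᶜ {_ ∷ _} {n} {k} 2≤ = inj₁ (s≤s (≤-trans (length-ω*fromℕ+ n k) 2≤))

count : List ℕ → ℕ
count []      = 0
count (c ∷ _) = c

short⇒fromℕ : ∀ h → Normal h → length h ≤ 1 → h ≡ fromℕ (count h)
short⇒fromℕ []           _ _ = refl
short⇒fromℕ (suc _ ∷ []) _ _ = refl
short⇒fromℕ (_ ∷ _ ∷ _)  _ (s≤s ())

-- The classes of a nonzero ω·m + l are keyed by fromℕ 0, …, fromℕ (lastClass m l).
lastClass : ℕ → ℕ → ℕ
lastClass m zero    = pred m
lastClass m (suc _) = m

lastClass-bound : ∀ m l → ω* fromℕ m + l ≢ [] →
  ∀ {h k} → (h , k) <ₗₑₓ (fromℕ m , l) → h <ᶜ fromℕ (suc (lastClass m l))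
lastClass-bound zero    zero    ≢[] _               = ⊥-elim (≢[] refl)
lastClass-bound (suc _) zero    _   (inj₁ p)        = p
lastClass-bound m       (suc _) _   (inj₁ p)        = <ᶜ-trans p (fromℕ-<ᶜ (n<1+n m))
lastClass-bound m       (suc _) _   (inj₂ (refl , _)) = fromℕ-<ᶜ (n<1+n m)

lastClass-within : ∀ m l → ω* fromℕ m + l ≢ [] →
  ∀ {n} → n ≤ lastClass m l → (fromℕ n , 0) <ₗₑₓ (fromℕ m , l)
lastClass-within zero    zero    ≢[] _   = ⊥-elim (≢[] refl)
lastClass-within (suc _) zero    _   n≤t = inj₁ (fromℕ-<ᶜ (s≤s n≤t))
lastClass-within m       (suc _) _   n≤m with m≤n⇒m<n∨m≡n n≤m
... | inj₁ n<m  = inj₁ (fromℕ-<ᶜ n<m)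
... | inj₂ refl = inj₂ (refl , s≤s z≤n)

data Size : List ℕ → Set where
  finite   : ∀ n → Size (fromℕ n)
  infinite : ∀ a b x → Size (a ∷ b ∷ x)

size : ∀ h → Normal h → Size h
size []           _ = finite 0
size (suc c ∷ []) _ = finite (suc c)
size (a ∷ b ∷ x)  _ = infinite a b x

-- Finitely many points

Finite : (C : Chain) → (Carrier C → Set) → Set
Finite C P = ∃ λ (ps : List (Carrier C)) → ∀ z → P z → Any (Eq C z) ps

module _ (C : Chain) where

  Finite-⊆ : {P Q : Carrier C → Set} → (∀ z → P z → Q z) → Finite C Q → Finite C P
  Finite-⊆ P⊆Q (ps , f) = ps , λ z → f z ∘ P⊆Q z

  Finite-∪ : {P Q : Carrier C → Set} → Finite C P → Finite C Q → Finite C (λ z → P z ⊎ Q z)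
  Finite-∪ (ps , f) (qs , g) = ps ++ qs , λ z → [ Any.++⁺ˡ ∘ f z , Any.++⁺ʳ ps ∘ g z ]′

  ¬Finite-unbounded : {P : Carrier C → Set} →
    (μ : Carrier C → ℕ) → (∀ {z w} → Eq C z w → μ z ≡ μ w) →
    (w : ℕ → Carrier C) (N₀ : ℕ) → (∀ N → N₀ < N → P (w N)) → (∀ N → μ (w N) ≡ N) →
    ¬ Finite C P
  ¬Finite-unbounded μ μ-resp w N₀ P-w μ-w (ps , f) = 1+n≰n (subst (_≤ M) (μ-w N) μ-w-N≤M)
    where
    M : ℕ
    M = max N₀ (List.map μ ps)
    N : ℕ
    N = suc M
    N₀<N : N₀ < N
    N₀<N = s≤s (⊥≤max N₀ (List.map μ ps))
    μ-w-N≤M : μ (w N) ≤ M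
    μ-w-N≤M = v≤max⁺ N₀ (List.map μ ps)
      (inj₂ (Any.gmap (≤-reflexive ∘ μ-resp) (f (w N) (P-w N N₀<N))))

module _ {A B : Chain} where

  ⊕-Finite⁺ : {P : Carrier A → Set} {Q : Carrier B → Set} →
    Finite A P → Finite B Q → Finite (A ⊕ B) [ P , Q ]′
  ⊕-Finite⁺ {P} {Q} (ps , f) (qs , g) = List.map inj₁ ps ++ List.map inj₂ qs , member
    where
    member : ∀ u → [ P , Q ]′ u → Any (Eq (A ⊕ B) u) (List.map inj₁ ps ++ List.map inj₂ qs)
    member (inj₁ a) p = Any.++⁺ˡ (Any.map⁺ (f a p))
    member (inj₂ b) q = Any.++⁺ʳ _ (Any.map⁺ (g b q))

  ⊕-Finite⁻ˡ : {P : Carrier (A ⊕ B) → Set} → Finite (A ⊕ B) P → Finite A (P ∘ inj₁)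
  ⊕-Finite⁻ˡ (ps , f) =
    mapMaybe isInj₁ ps , λ a p → Any.mapMaybe⁺ isInj₁ ps (Any.gmap just-Eq (f (inj₁ a) p))
    where
    just-Eq : ∀ {a u} → Eq (A ⊕ B) (inj₁ a) u → MaybeAny.Any (Eq A a) (isInj₁ u)
    just-Eq {u = inj₁ _} e = just e

  ⊕-Finite⁻ʳ : {P : Carrier (A ⊕ B) → Set} → Finite (A ⊕ B) P → Finite B (P ∘ inj₂)
  ⊕-Finite⁻ʳ (ps , f) =
    mapMaybe isInj₂ ps , λ b p → Any.mapMaybe⁺ isInj₂ ps (Any.gmap just-Eq (f (inj₂ b) p))
    where
    just-Eq : ∀ {b u} → Eq (A ⊕ B) (inj₂ b) u → MaybeAny.Any (Eq B b) (isInj₂ u)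
    just-Eq {u = inj₂ _} e = just e

Between-sym : (C : Chain) {x z y : Carrier C} → Between C x z y → Between C y z x
Between-sym C = [ inj₂ , inj₁ ]′

FinEq-sym : (C : Chain) {x y : Carrier C} → FinEq C x y → FinEq C y x
FinEq-sym C = Finite-⊆ C (λ _ → Between-sym C)

module _ {A B : Chain} where

  ⊕-FinEq⁺ˡ : ∀ {x y} → FinEq A x y → FinEq (A ⊕ B) (inj₁ x) (inj₁ y)
  ⊕-FinEq⁺ˡ {x} {y} fin = Finite-⊆ (A ⊕ B) inside (⊕-Finite⁺ fin ([] , λ _ ()))
    where
    inside : ∀ u → Between (A ⊕ B) (inj₁ x) u (inj₁ y) →
             [ (λ z → Between A x z y) , (λ _ → ⊥) ]′ u
    inside (inj₁ _) b = b
    inside (inj₂ _) (inj₁ (_ , ()))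
    inside (inj₂ _) (inj₂ (_ , ()))

  ⊕-FinEq⁺ʳ : ∀ {x y} → FinEq B x y → FinEq (A ⊕ B) (inj₂ x) (inj₂ y)
  ⊕-FinEq⁺ʳ {x} {y} fin = Finite-⊆ (A ⊕ B) inside (⊕-Finite⁺ ([] , λ _ ()) fin)
    where
    inside : ∀ u → Between (A ⊕ B) (inj₂ x) u (inj₂ y) →
             [ (λ _ → ⊥) , (λ z → Between B x z y) ]′ u
    inside (inj₁ _) (inj₁ (() , _))
    inside (inj₁ _) (inj₂ (() , _))
    inside (inj₂ _) b = b

  ⊕-FinEq⁻ˡ : ∀ {x y} → FinEq (A ⊕ B) (inj₁ x) (inj₁ y) → FinEq A x y
  ⊕-FinEq⁻ˡ = ⊕-Finite⁻ˡ

  ⊕-FinEq⁻ʳ : ∀ {x y} → FinEq (A ⊕ B) (inj₂ x) (inj₂ y) → FinEq B x y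
  ⊕-FinEq⁻ʳ = ⊕-Finite⁻ʳ

  ⊕-FinEq-across⁺ : ∀ {x y} → Finite A (Lt A x) → Finite B (λ z → Lt B z y) →
    FinEq (A ⊕ B) (inj₁ x) (inj₂ y)
  ⊕-FinEq-across⁺ {x} {y} above below = Finite-⊆ (A ⊕ B) inside (⊕-Finite⁺ above below)
    where
    inside : ∀ u → Between (A ⊕ B) (inj₁ x) u (inj₂ y) → [ Lt A x , (λ z → Lt B z y) ]′ u
    inside (inj₁ _) (inj₁ (x<z , _)) = x<z
    inside (inj₁ _) (inj₂ (() , _))
    inside (inj₂ _) (inj₁ (_ , z<y)) = z<y
    inside (inj₂ _) (inj₂ (_ , ()))

  ⊕-FinEq-across⁻ : ∀ {x y} → FinEq (A ⊕ B) (inj₁ x) (inj₂ y) →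
    Finite A (Lt A x) × Finite B (λ z → Lt B z y)
  ⊕-FinEq-across⁻ fin = Finite-⊆ A (λ _ x<z → inj₁ (x<z , tt)) (⊕-Finite⁻ˡ fin)
                        , Finite-⊆ B (λ _ z<y → inj₁ (tt , z<y)) (⊕-Finite⁻ʳ fin)

-- Presenting chains by keys

record Keying (C : Chain) {K : Set} (_<_ : K → K → Set) : Set where
  field
    key    : Carrier C → K
    key-≈  : ∀ {x y} → Eq C x y → key x ≡ key y
    key-≈⁻ : ∀ {x y} → key x ≡ key y → Eq C x y
    key-<  : ∀ {x y} → Lt C x y → key x < key y
    key-<⁻ : ∀ {x y} → key x < key y → Lt C x y

module _ {A B : Chain} {K : Set} {_<_ : K → K → Set} (S : Keying A _<_) (T : Keying B _<_) where
  private
    module S = Keying S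
    module T = Keying T

  ≅-by-keys : (f : Carrier A → Carrier B) (g : Carrier B → Carrier A) →
    (∀ a → T.key (f a) ≡ S.key a) → (∀ b → S.key (g b) ≡ T.key b) → A ≅ B
  ≅-by-keys f g f-key g-key = record
    { to      = f
    ; from    = g
    ; to-≈    = λ {x} {y} x≈y → T.key-≈⁻ (trans (f-key x) (trans (S.key-≈ x≈y) (sym (f-key y))))
    ; to-<    = λ {x} {y} x<y → T.key-<⁻ (subst₂ _<_ (sym (f-key x)) (sym (f-key y)) (S.key-< x<y))
    ; from-≈  = λ {x} {y} x≈y → S.key-≈⁻ (trans (g-key x) (trans (T.key-≈ x≈y) (sym (g-key y))))
    ; from-<  = λ {x} {y} x<y → S.key-<⁻ (subst₂ _<_ (sym (g-key x)) (sym (g-key y)) (T.key-< x<y))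
    ; from∘to = λ x → S.key-≈⁻ (trans (g-key (f x)) (f-key x))
    ; to∘from = λ y → T.key-≈⁻ (trans (f-key (g y)) (g-key y))
    }

  ⊕-keying : Keying (A ⊕ B) (_<_ ⊎-< _<_)
  ⊕-keying = record
    { key    = key
    ; key-≈  = λ {x} {y} → key-≈ {x} {y}
    ; key-≈⁻ = λ {x} {y} → key-≈⁻ {x} {y}
    ; key-<  = λ {x} {y} → key-< {x} {y}
    ; key-<⁻ = λ {x} {y} → key-<⁻ {x} {y}
    }
    where
    key : Carrier (A ⊕ B) → K ⊎ K
    key = Sum.map S.key T.key
    key-≈ : ∀ {x y} → Eq (A ⊕ B) x y → key x ≡ key y
    key-≈ {inj₁ _} {inj₁ _} e = cong inj₁ (S.key-≈ e)
    key-≈ {inj₂ _} {inj₂ _} e = cong inj₂ (T.key-≈ e)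
    key-≈⁻ : ∀ {x y} → key x ≡ key y → Eq (A ⊕ B) x y
    key-≈⁻ {inj₁ _} {inj₁ _} e = S.key-≈⁻ (inj₁-injective e)
    key-≈⁻ {inj₂ _} {inj₂ _} e = T.key-≈⁻ (inj₂-injective e)
    key-< : ∀ {x y} → Lt (A ⊕ B) x y → (_<_ ⊎-< _<_) (key x) (key y)
    key-< {inj₁ _} {inj₁ _} x<y = ₁∼₁ (S.key-< x<y)
    key-< {inj₁ _} {inj₂ _} _   = ₁∼₂
    key-< {inj₂ _} {inj₂ _} x<y = ₂∼₂ (T.key-< x<y)
    key-<⁻ : ∀ {x y} → (_<_ ⊎-< _<_) (key x) (key y) → Lt (A ⊕ B) x y
    key-<⁻ {inj₁ _} {inj₁ _} (₁∼₁ p) = S.key-<⁻ p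
    key-<⁻ {inj₁ _} {inj₂ _} ₁∼₂     = tt
    key-<⁻ {inj₂ _} {inj₂ _} (₂∼₂ p) = T.key-<⁻ p

module _ {C : Chain} {K : Set} {_<_ : K → K → Set} (S : Keying C _<_) where
  private
    module S = Keying S

  ⊕One-keying : Asymmetric _<_ → (t : K) → (∀ c → S.key c < t) → Keying (C ⊕ One) _<_
  ⊕One-keying asym t below = record
    { key    = key
    ; key-≈  = λ {x} {y} → key-≈ {x} {y}
    ; key-≈⁻ = λ {x} {y} → key-≈⁻ {x} {y}
    ; key-<  = λ {x} {y} → key-< {x} {y}
    ; key-<⁻ = λ {x} {y} → key-<⁻ {x} {y}
    }
    where
    key : Carrier (C ⊕ One) → K
    key = [ S.key , (λ _ → t) ]′
    t≮t : ¬ (t < t)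
    t≮t t<t = asym t<t t<t
    key-≈ : ∀ {x y} → Eq (C ⊕ One) x y → key x ≡ key y
    key-≈ {inj₁ _} {inj₁ _} e = S.key-≈ e
    key-≈ {inj₂ _} {inj₂ _} _ = refl
    key-≈⁻ : ∀ {x y} → key x ≡ key y → Eq (C ⊕ One) x y
    key-≈⁻ {inj₁ _} {inj₁ _} e = S.key-≈⁻ e
    key-≈⁻ {inj₁ c} {inj₂ _} e = t≮t (subst (_< t) e (below c))
    key-≈⁻ {inj₂ _} {inj₁ c} e = t≮t (subst (_< t) (sym e) (below c))
    key-≈⁻ {inj₂ _} {inj₂ _} _ = tt
    key-< : ∀ {x y} → Lt (C ⊕ One) x y → key x < key y
    key-< {inj₁ _} {inj₁ _} x<y = S.key-< x<y
    key-< {inj₁ c} {inj₂ _} _   = below c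
    key-<⁻ : ∀ {x y} → key x < key y → Lt (C ⊕ One) x y
    key-<⁻ {inj₁ _} {inj₁ _} p = S.key-<⁻ p
    key-<⁻ {inj₁ _} {inj₂ _} _ = tt
    key-<⁻ {inj₂ _} {inj₁ c} p = asym p (below c)
    key-<⁻ {inj₂ _} {inj₂ _} p = t≮t p

  Keying-map : {K′ : Set} {_<′_ : K′ → K′ → Set} → Trichotomy _<_ → Asymmetric _<′_ →
    (f : K → K′) (P : K → Set) → (∀ c → P (S.key c)) →
    (∀ {a b} → P a → P b → a < b → f a <′ f b) →
    Keying C _<′_
  Keying-map {_<′_ = _<′_} tri asym f P P-key f-mono = record
    { key    = f ∘ S.key
    ; key-≈  = cong f ∘ S.key-≈
    ; key-≈⁻ = λ {x} {y} → S.key-≈⁻ ∘ f-injective (P-key x) (P-key y)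
    ; key-<  = λ {x} {y} → f-mono (P-key x) (P-key y) ∘ S.key-<
    ; key-<⁻ = λ {x} {y} → S.key-<⁻ ∘ f-mono⁻ (P-key x) (P-key y)
    }
    where
    irrefl : ∀ {a} → ¬ (a <′ a)
    irrefl a<a = asym a<a a<a
    f-injective : ∀ {a b} → P a → P b → f a ≡ f b → a ≡ b
    f-injective {a} {b} pa pb e with tri a b
    ... | inj₁ a<b        = ⊥-elim (irrefl (subst (f a <′_) (sym e) (f-mono pa pb a<b)))
    ... | inj₂ (inj₁ a≡b) = a≡b
    ... | inj₂ (inj₂ b<a) = ⊥-elim (irrefl (subst (f b <′_) e (f-mono pb pa b<a)))
    f-mono⁻ : ∀ {a b} → P a → P b → f a <′ f b → a < b
    f-mono⁻ {a} {b} pa pb fa<fb with tri a b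
    ... | inj₁ a<b        = a<b
    ... | inj₂ (inj₁ refl) = ⊥-elim (irrefl fa<fb)
    ... | inj₂ (inj₂ b<a) = ⊥-elim (asym fa<fb (f-mono pb pa b<a))

record ClassKey (C : Chain) {K : Set} (_<_ : K → K → Set) : Set where
  field
    key        : Carrier C → K
    trichotomy : Trichotomy _<_
    key-≤      : ∀ {x y} → Lt C x y → key x < key y ⊎ key x ≡ key y
    key-<⁻     : ∀ {x y} → key x < key y → Lt C x y
    ≡⇒FinEq    : ∀ {x y} → key x ≡ key y → FinEq C x y
    <⇒¬FinEq   : ∀ {x y} → key x < key y → ¬ FinEq C x y

  FinEq⇒≡ : ∀ {x y} → FinEq C x y → key x ≡ key y
  FinEq⇒≡ {x} {y} fin with trichotomy (key x) (key y)
  ... | inj₁ x<y        = ⊥-elim (<⇒¬FinEq x<y fin)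
  ... | inj₂ (inj₁ x≡y) = x≡y
  ... | inj₂ (inj₂ y<x) = ⊥-elim (<⇒¬FinEq y<x (FinEq-sym C fin))

  keying : Keying (Cond C) _<_
  keying = record
    { key    = key
    ; key-≈  = FinEq⇒≡
    ; key-≈⁻ = ≡⇒FinEq
    ; key-<  = λ (x<y , ¬fin) → [ id , ⊥-elim ∘ ¬fin ∘ ≡⇒FinEq ]′ (key-≤ x<y)
    ; key-<⁻ = λ x<y → key-<⁻ x<y , <⇒¬FinEq x<y
    }

-- The condensation of an ordinal

cnf : {P : CNF → Set} → Σ CNF P → List ℕ
cnf = proj₁ ∘ proj₁

cnf-Normal : {P : CNF → Set} (p : Σ CNF P) → Normal (cnf p)
cnf-Normal = proj₂ ∘ proj₁

point : (γ : CNF) (h : List ℕ) → Normal h → (k : ℕ) → ω* h + k <ᶜ proj₁ γ → Pt γ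
point γ h nh k p = (ω* h + k , Normal-ω*+ h k nh) , p

segment-Finite : (γ : CNF) (h : List ℕ) (nh : Normal h) (n : ℕ) →
  (∀ {k} → k < n → ω* h + k <ᶜ proj₁ γ) →
  Finite (ordChain γ) (λ z → divω (cnf z) ≡ h × modω (cnf z) < n)
segment-Finite γ h nh zero    _    = [] , λ _ ()
segment-Finite γ h nh (suc n) in-γ with segment-Finite γ h nh n (in-γ ∘ m<n⇒m<1+n)
... | ps , f = point γ h nh n (in-γ (n<1+n n)) ∷ ps , member
  where
  member : ∀ z → divω (cnf z) ≡ h × modω (cnf z) < suc n →
           Any (Eq (ordChain γ) z) (point γ h nh n (in-γ (n<1+n n)) ∷ ps)
  member z (e , k<1+n) with m<1+n⇒m<n∨m≡n k<1+n
  ... | inj₁ k<n  = Any.there (f z (e , k<n))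
  ... | inj₂ refl =
    Any.here (trans (sym (ω*divω+modω (cnf z) (cnf-Normal z))) (cong (λ h → ω* h + n) e))

classBelow-Finite : (γ : CNF) (u : List ℕ) → Normal u → u ≤ᶜ proj₁ γ →
  Finite (ordChain γ) (λ z → cnf z ≺-in-class u)
classBelow-Finite γ u nu u≤γ = segment-Finite γ (divω u) (Normal-divω u nu) (modω u)
  (λ k<m → <ᶜ-≤ᶜ-trans (ω*divω+<ᶜ nu k<m) u≤γ)

ray-¬Finite : (γ : CNF) (h : List ℕ) (nh : Normal h) (k : ℕ) →
  (in-γ : ∀ N → ω* h + N <ᶜ proj₁ γ) →
  {P : Pt γ → Set} → (∀ N → k < N → P (point γ h nh N (in-γ N))) → ¬ Finite (ordChain γ) P
ray-¬Finite γ h nh k in-γ P-ray =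
  ¬Finite-unbounded (ordChain γ) (λ z → modω (cnf z)) (cong modω)
    (λ N → point γ h nh N (in-γ N)) k P-ray (modω-ω*+ h)

module _ (γ : CNF) where
  private
    C : Chain
    C = ordChain γ
    nγ : Normal (proj₁ γ)
    nγ = proj₂ γ

  same-divω⇒FinEq : (x y : Pt γ) → divω (cnf x) ≡ divω (cnf y) → FinEq C x y
  same-divω⇒FinEq x y x~y = Finite-⊆ C inside
    (Finite-∪ C (classBelow-Finite γ (cnf y) (cnf-Normal y) (inj₁ (proj₂ y)))
                (classBelow-Finite γ (cnf x) (cnf-Normal x) (inj₁ (proj₂ x))))
    where
    inside : ∀ z → Between C x z y → cnf z ≺-in-class cnf y ⊎ cnf z ≺-in-class cnf x
    inside z (inj₁ (x<z , z<y)) =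
      inj₁ (between-same-divω (cnf-Normal x) (cnf-Normal z) (cnf-Normal y) x<z z<y x~y)
    inside z (inj₂ (y<z , z<x)) =
      inj₂ (between-same-divω (cnf-Normal y) (cnf-Normal z) (cnf-Normal x) y<z z<x (sym x~y))

  divω<⇒¬FinEq : (x y : Pt γ) → divω (cnf x) <ᶜ divω (cnf y) → ¬ FinEq C x y
  divω<⇒¬FinEq x y x≺y = ray-¬Finite γ (divω (cnf x)) (Normal-divω _ (cnf-Normal x)) (modω (cnf x))
    (λ N → <ᶜ-trans (ω*+<ᶜ (cnf-Normal y) x≺y) (proj₂ y))
    (λ N k<N → inj₁ (<ᶜω*divω+ (cnf-Normal x) k<N , ω*+<ᶜ (cnf-Normal y) x≺y))

  last-class⇒Finite-above : (x : Pt γ) → divω (cnf x) ≡ divω (proj₁ γ) → Finite C (Lt C x)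
  last-class⇒Finite-above x x~γ = Finite-⊆ C
    (λ z x<z → between-same-divω (cnf-Normal x) (cnf-Normal z) nγ x<z (proj₂ z) x~γ)
    (classBelow-Finite γ (proj₁ γ) nγ (inj₂ refl))

  below-last-class⇒¬Finite-above : (x : Pt γ) → divω (cnf x) <ᶜ divω (proj₁ γ) →
    ¬ Finite C (Lt C x)
  below-last-class⇒¬Finite-above x x≺γ =
    ray-¬Finite γ (divω (cnf x)) (Normal-divω _ (cnf-Normal x)) (modω (cnf x))
      (λ N → ω*+<ᶜ nγ x≺γ) (λ N k<N → <ᶜω*divω+ (cnf-Normal x) k<N)

  first-class⇒Finite-below : (y : Pt γ) → divω (cnf y) ≡ [] → Finite C (λ z → Lt C z y)
  first-class⇒Finite-below y y~0 = Finite-⊆ C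
    (λ z z<y → same-divω-<ᶜ (cnf-Normal z) (cnf-Normal y) z<y
                 (≮ᶜ[] ∘ subst (divω (cnf z) <ᶜ_) y~0))
    (classBelow-Finite γ (cnf y) (cnf-Normal y) (inj₁ (proj₂ y)))

  above-first-class⇒¬Finite-below : (y : Pt γ) → [] <ᶜ divω (cnf y) → ¬ Finite C (λ z → Lt C z y)
  above-first-class⇒¬Finite-below y 0≺y = ray-¬Finite γ [] tt 0
    (λ N → <ᶜ-trans (ω*+<ᶜ (cnf-Normal y) 0≺y) (proj₂ y)) (λ N _ → ω*+<ᶜ (cnf-Normal y) 0≺y)

  ordinal-classKey : ClassKey C _<ᶜ_
  ordinal-classKey = record
    { key        = λ x → divω (cnf x)
    ; trichotomy = <ᶜ-trichotomy
    ; key-≤      = λ {x} {y} → divω-mono (cnf-Normal x) (cnf-Normal y)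
    ; key-<⁻     = λ {x} {y} → divω-<ᶜ⁻ (cnf-Normal x) (cnf-Normal y)
    ; ≡⇒FinEq    = λ {x} {y} → same-divω⇒FinEq x y
    ; <⇒¬FinEq   = λ {x} {y} → divω<⇒¬FinEq x y
    }

D-keying : (γ : CNF) → Keying (D γ) _<ᶜ_
D-keying γ = ClassKey.keying (ordinal-classKey γ)

module FinitelyManyClasses (β : CNF) (β≢0 : Nonzero β) (deg<2 : deg β < 2) where
  private
    bβ : List ℕ
    bβ = proj₁ β
    nb : Normal bβ
    nb = proj₂ β
    mβ : ℕ
    mβ = count (divω bβ)
    lβ : ℕ
    lβ = modω bβ

    divω-β : divω bβ ≡ fromℕ mβ
    divω-β = short⇒fromℕ (divω bβ) (Normal-divω bβ nb)
      (subst (_≤ 1) (sym (length-divω bβ)) (≤-pred deg<2))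

    β-form : ω* fromℕ mβ + lβ ≡ bβ
    β-form = trans (cong (λ h → ω* h + lβ) (sym divω-β)) (ω*divω+modω bβ nb)

    ≢[] : ω* fromℕ mβ + lβ ≢ []
    ≢[] = β≢0 ∘ trans (sym β-form)

  top : ℕ
  top = lastClass mβ lβ

  divω<top+1 : (y : Pt β) → divω (cnf y) <ᶜ fromℕ (suc top)
  divω<top+1 y = lastClass-bound mβ lβ ≢[]
    (subst (divModω (cnf y) <ₗₑₓ_) (cong (_, lβ) divω-β) (<ᶜ⇒<ₗₑₓ (cnf-Normal y) nb (proj₂ y)))

  ≤top⇒∈β : ∀ {n} → n ≤ top → ω* fromℕ n + 0 <ᶜ proj₁ β
  ≤top⇒∈β {n} n≤top = subst (ω* fromℕ n + 0 <ᶜ_) β-form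
    (ω*+-<ᶜ⁺ (fromℕ n) (fromℕ mβ) (lastClass-within mβ lβ ≢[] n≤top))

module _ (α : CNF) where
  private
    nα : Normal (proj₁ α)
    nα = proj₂ α
    aα : List ℕ
    aα = divω (proj₁ α)
    mα : ℕ
    mα = modω (proj₁ α)

  lastPoint : 0 < mα → Pt α
  lastPoint 0<m =
    point α aα (Normal-divω _ nα) (pred mα) (ω*divω+<ᶜ nα (m≤pred[n]⇒suc[m]≤n ≤-refl))
    where instance _ = >-nonZero 0<m

  lastPoint-maximal : (0<m : 0 < mα) (q : Pt α) → ¬ Lt (ordChain α) (lastPoint 0<m) q
  lastPoint-maximal 0<m q p<q = <⇒≱ q<m m≤q
    where
    instance _ = >-nonZero 0<m
    p : Pt α
    p = lastPoint 0<m
    np : Normal (cnf p)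
    np = cnf-Normal p
    nq : Normal (cnf q)
    nq = cnf-Normal q
    p~α : divω (cnf p) ≡ aα
    p~α = divω-ω*+ aα (pred mα)
    q-in-last-class : cnf q ≺-in-class proj₁ α
    q-in-last-class = between-same-divω np nq nα p<q (proj₂ q) p~α
    q<m : modω (cnf q) < mα
    q<m = proj₂ q-in-last-class
    p<ₘq : modω (cnf p) < modω (cnf q)
    p<ₘq = proj₂ (same-divω-<ᶜ np nq p<q (<ᶜ-irrefl ∘ subst₂ _<ᶜ_ p~α (proj₁ q-in-last-class)))
    m≤q : mα ≤ modω (cnf q)
    m≤q = subst (_≤ modω (cnf q)) (trans (cong suc (modω-ω*+ aα (pred mα))) (suc-pred mα)) p<ₘq

  0<modω⇒IsSucc : 0 < mα → IsSucc α
  0<modω⇒IsSucc 0<m = lastPoint 0<m , lastPoint-maximal 0<m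

  IsSucc⇒0<modω : IsSucc α → 0 < mα
  IsSucc⇒0<modω (p , maximal) with <ᶜ⇒<ₗₑₓ (cnf-Normal p) nα (proj₂ p)
  ... | inj₂ (_ , p<m) = ≤-<-trans z≤n p<m
  ... | inj₁ p≺α       = ⊥-elim (maximal q (<ᶜω*divω+ (cnf-Normal p) (n<1+n _)))
    where
    q : Pt α
    q = point α (divω (cnf p)) (Normal-divω _ (cnf-Normal p)) (suc (modω (cnf p))) (ω*+<ᶜ nα p≺α)

-- The condensation of an ordered sum

_<ᴷ_ : List ℕ ⊎ List ℕ → List ℕ ⊎ List ℕ → Set
_<ᴷ_ = _<ᶜ_ ⊎-< _<ᶜ_

module SumClasses (α β : CNF) where
  private
    C : Chain
    C = ordChain α ⊕ ordChain β
    nα : Normal (proj₁ α)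
    nα = proj₂ α
    aα : List ℕ
    aα = divω (proj₁ α)
    mα : ℕ
    mα = modω (proj₁ α)

  -- The first class [] of β is merged into the last class of α iff the latter is a nonempty
  -- finite block, i.e. iff modω α > 0.
  βkey : List ℕ → ℕ → List ℕ ⊎ List ℕ
  βkey []      zero    = inj₂ []
  βkey []      (suc _) = inj₁ aα
  βkey (c ∷ h) _       = inj₂ (c ∷ h)

  key : Carrier C → List ℕ ⊎ List ℕ
  key (inj₁ x) = inj₁ (divω (cnf x))
  key (inj₂ y) = βkey (divω (cnf y)) mα

  βkey-< : ∀ {h h′} m → h <ᶜ h′ → βkey h m <ᴷ βkey h′ m
  βkey-< {[]}    {[]}    _       p = ⊥-elim (<ᶜ-irrefl p)
  βkey-< {[]}    {_ ∷ _} zero    p = ₂∼₂ p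
  βkey-< {[]}    {_ ∷ _} (suc _) _ = ₁∼₂
  βkey-< {_ ∷ _} {[]}    _       p = ⊥-elim (≮ᶜ[] p)
  βkey-< {_ ∷ _} {_ ∷ _} _       p = ₂∼₂ p

  βkey-<⁻ : ∀ h h′ m → βkey h m <ᴷ βkey h′ m → h <ᶜ h′
  βkey-<⁻ []      []      zero    (₂∼₂ p) = p
  βkey-<⁻ []      []      (suc _) (₁∼₁ p) = ⊥-elim (<ᶜ-irrefl p)
  βkey-<⁻ []      (_ ∷ _) _       _       = []<ᶜ∷
  βkey-<⁻ (_ ∷ _) []      zero    (₂∼₂ p) = p
  βkey-<⁻ (_ ∷ _) (_ ∷ _) _       (₂∼₂ p) = p

  βkey-injective : ∀ h h′ m → βkey h m ≡ βkey h′ m → h ≡ h′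
  βkey-injective []      []      _    _ = refl
  βkey-injective []      (_ ∷ _) zero e = inj₂-injective e
  βkey-injective (_ ∷ _) []      zero e = inj₂-injective e
  βkey-injective (_ ∷ _) (_ ∷ _) _    e = inj₂-injective e

  below-βkey : ∀ h m {d} → d ≤ᶜ aα → inj₁ d <ᴷ βkey h m ⊎ inj₁ d ≡ βkey h m
  below-βkey []      zero    _   = inj₁ ₁∼₂
  below-βkey []      (suc _) d≤α = Sum.map ₁∼₁ (cong inj₁) d≤α
  below-βkey (_ ∷ _) _       _   = inj₁ ₁∼₂

  βkey≮ : ∀ h m {d} → d ≤ᶜ aα → ¬ (βkey h m <ᴷ inj₁ d)
  βkey≮ [] (suc _) d≤α (₁∼₁ α<d) = <ᶜ-irrefl (<ᶜ-≤ᶜ-trans α<d d≤α)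

  βkey≡inj₁ : ∀ h m {d} → inj₁ d ≡ βkey h m → h ≡ [] × d ≡ aα
  βkey≡inj₁ [] (suc _) e = refl , inj₁-injective e

  βkey-[] : ∀ {m} → 0 < m → βkey [] m ≡ inj₁ aα
  βkey-[] (s≤s _) = refl

  βkey<inj₂ : ∀ h m {h′} → h <ᶜ h′ → βkey h m <ᴷ inj₂ h′
  βkey<inj₂ []      zero    p = ₂∼₂ p
  βkey<inj₂ []      (suc _) _ = ₁∼₂
  βkey<inj₂ (_ ∷ _) _       p = ₂∼₂ p

  inj₁<βkey : ∀ h m → 0 < m → inj₁ aα <ᴷ βkey h m → [] <ᶜ h
  inj₁<βkey []      (suc _) _ (₁∼₁ α<α) = ⊥-elim (<ᶜ-irrefl α<α)
  inj₁<βkey (_ ∷ _) _       _ _         = []<ᶜ∷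

  divω≤α : (x : Pt α) → divω (cnf x) ≤ᶜ aα
  divω≤α x = divω-mono (cnf-Normal x) nα (proj₂ x)

  across-FinEq : (x : Pt α) (y : Pt β) → inj₁ (divω (cnf x)) ≡ βkey (divω (cnf y)) mα →
    FinEq C (inj₁ x) (inj₂ y)
  across-FinEq x y e with βkey≡inj₁ (divω (cnf y)) mα e
  ... | y~0 , x~α =
    ⊕-FinEq-across⁺ (last-class⇒Finite-above α x x~α) (first-class⇒Finite-below β y y~0)

  across-¬FinEq : (x : Pt α) (y : Pt β) → inj₁ (divω (cnf x)) <ᴷ βkey (divω (cnf y)) mα →
    ¬ FinEq C (inj₁ x) (inj₂ y)
  across-¬FinEq x y x<y fin with ⊕-FinEq-across⁻ fin | divω≤α x
  ... | above , _     | inj₁ x≺α = below-last-class⇒¬Finite-above α x x≺α above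
  ... | _     , below | inj₂ x~α =
    above-first-class⇒¬Finite-below β y
      (inj₁<βkey (divω (cnf y)) mα 0<m (subst (λ d → inj₁ d <ᴷ _) x~α x<y)) below
    where
    0<m : 0 < mα
    0<m = ≤-<-trans z≤n
      (proj₂ (same-divω-<ᶜ (cnf-Normal x) nα (proj₂ x) (<ᶜ-irrefl ∘ subst (_<ᶜ aα) x~α)))

  classKey : ClassKey C _<ᴷ_
  classKey = record
    { key        = key
    ; trichotomy = ⊎-<-trichotomy <ᶜ-trichotomy <ᶜ-trichotomy
    ; key-≤      = λ {u} {v} → key-≤ {u} {v}
    ; key-<⁻     = λ {u} {v} → key-<⁻ {u} {v}
    ; ≡⇒FinEq    = λ {u} {v} → ≡⇒FinEq {u} {v}
    ; <⇒¬FinEq   = λ {u} {v} → <⇒¬FinEq {u} {v}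
    }
    where
    key-≤ : ∀ {u v} → Lt C u v → key u <ᴷ key v ⊎ key u ≡ key v
    key-≤ {inj₁ x} {inj₁ y} x<y = Sum.map ₁∼₁ (cong inj₁) (divω-mono (cnf-Normal x) (cnf-Normal y) x<y)
    key-≤ {inj₁ x} {inj₂ y} _   = below-βkey (divω (cnf y)) mα (divω≤α x)
    key-≤ {inj₂ x} {inj₂ y} x<y =
      Sum.map (βkey-< mα) (cong (λ h → βkey h mα)) (divω-mono (cnf-Normal x) (cnf-Normal y) x<y)

    key-<⁻ : ∀ {u v} → key u <ᴷ key v → Lt C u v
    key-<⁻ {inj₁ x} {inj₁ y} (₁∼₁ p) = divω-<ᶜ⁻ (cnf-Normal x) (cnf-Normal y) p
    key-<⁻ {inj₁ _} {inj₂ _} _       = tt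
    key-<⁻ {inj₂ y} {inj₁ x} p       = βkey≮ (divω (cnf y)) mα (divω≤α x) p
    key-<⁻ {inj₂ x} {inj₂ y} p       = divω-<ᶜ⁻ (cnf-Normal x) (cnf-Normal y) (βkey-<⁻ _ _ mα p)

    ≡⇒FinEq : ∀ {u v} → key u ≡ key v → FinEq C u v
    ≡⇒FinEq {inj₁ x} {inj₁ y} e = ⊕-FinEq⁺ˡ (same-divω⇒FinEq α x y (inj₁-injective e))
    ≡⇒FinEq {inj₁ x} {inj₂ y} e = across-FinEq x y e
    ≡⇒FinEq {inj₂ y} {inj₁ x} e = FinEq-sym C (across-FinEq x y (sym e))
    ≡⇒FinEq {inj₂ x} {inj₂ y} e = ⊕-FinEq⁺ʳ (same-divω⇒FinEq β x y (βkey-injective _ _ mα e))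

    <⇒¬FinEq : ∀ {u v} → key u <ᴷ key v → ¬ FinEq C u v
    <⇒¬FinEq {inj₁ x} {inj₁ y} (₁∼₁ p) = divω<⇒¬FinEq α x y p ∘ ⊕-FinEq⁻ˡ
    <⇒¬FinEq {inj₁ x} {inj₂ y} p       = across-¬FinEq x y p
    <⇒¬FinEq {inj₂ y} {inj₁ x} p       = ⊥-elim (βkey≮ (divω (cnf y)) mα (divω≤α x) p)
    <⇒¬FinEq {inj₂ x} {inj₂ y} p       = divω<⇒¬FinEq β x y (βkey-<⁻ _ _ mα p) ∘ ⊕-FinEq⁻ʳ

D+-keying : (α β : CNF) → Keying (D+ α β) _<ᴷ_
D+-keying α β = ClassKey.keying (SumClasses.classKey α β)

D⊕D-keying : (α β : CNF) → Keying (D α ⊕ D β) _<ᴷ_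
D⊕D-keying α β = ⊕-keying (D-keying α) (D-keying β)

limit-iso : (α β : CNF) → modω (proj₁ α) ≡ 0 → D+ α β ≅ (D α ⊕ D β)
limit-iso α β m≡0 = ≅-by-keys (D+-keying α β) (D⊕D-keying α β) id id same-key (sym ∘ same-key)
  where
  open SumClasses α β using (βkey)
  βkey-0 : ∀ h → βkey h 0 ≡ inj₂ h
  βkey-0 []      = refl
  βkey-0 (_ ∷ _) = refl
  same-key : ∀ u → Keying.key (D⊕D-keying α β) u ≡ Keying.key (D+-keying α β) u
  same-key (inj₁ _) = refl
  same-key (inj₂ y) = sym (trans (cong (βkey (divω (cnf y))) m≡0) (βkey-0 (divω (cnf y))))

-- Sums with a successor on the left

module Successor (α β : CNF) (0<m : 0 < modω (proj₁ α)) where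
  private
    open SumClasses α β using (βkey; βkey-[]; βkey<inj₂)
    aα : List ℕ
    aα = divω (proj₁ α)
    mα : ℕ
    mα = modω (proj₁ α)
    S : Keying (D+ α β) _<ᴷ_
    S = D+-keying α β
    module S = Keying S

  shifted-target : Keying (D α ⊕ D β) _<ᴷ_
  shifted-target = ⊕-keying (D-keying α)
    (Keying-map (D-keying β) <ᶜ-trichotomy <ᶜ-asym 1+ Normal
      (λ y → Normal-divω _ (cnf-Normal y)) 1+-mono)

  private
    module T = Keying shifted-target

  finitePoint : (n : ℕ) → ω* fromℕ n + 0 <ᶜ proj₁ β → Pt β
  finitePoint n = point β (fromℕ n) (Normal-ω*+ [] n tt) 0

  toβ : (y : Pt β) {h : List ℕ} → h ≡ divω (cnf y) → Size h → Carrier (D α ⊕ D β)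
  toβ y _  (finite zero)    = inj₁ (lastPoint α 0<m)
  toβ y eq (finite (suc n)) = inj₂ (finitePoint n
    (<ᶜ-trans (ω*+<ᶜ (cnf-Normal y) (subst (fromℕ n <ᶜ_) eq (fromℕ-<ᶜ (n<1+n n)))) (proj₂ y)))
  toβ y _  (infinite _ _ _) = inj₂ y

  toβ-key : (y : Pt β) {h : List ℕ} (eq : h ≡ divω (cnf y)) (s : Size h) →
    T.key (toβ y eq s) ≡ βkey h mα
  toβ-key y _  (finite zero)    = trans (cong inj₁ (divω-ω*+ aα (pred mα))) (sym (βkey-[] 0<m))
  toβ-key y _  (finite (suc n)) = cong inj₂ (1+-divω-ω*fromℕ+ n 0)
  toβ-key y eq (infinite a b x) = cong (inj₂ ∘ 1+) (sym eq)

  to : Carrier (D+ α β) → Carrier (D α ⊕ D β)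
  to (inj₁ x) = inj₁ x
  to (inj₂ y) = toβ y refl (size _ (Normal-divω _ (cnf-Normal y)))

  to-key : ∀ u → T.key (to u) ≡ S.key u
  to-key (inj₁ x) = refl
  to-key (inj₂ y) = toβ-key y refl (size _ (Normal-divω _ (cnf-Normal y)))

  βkey-ω*fromℕ+ : ∀ n k → βkey (divω (ω* fromℕ (suc n) + k)) mα ≡ inj₂ (1+ (fromℕ n))
  βkey-ω*fromℕ+ n k =
    trans (cong (λ h → βkey h mα) (divω-ω*+ (fromℕ (suc n)) k)) (cong inj₂ (sym (1+-fromℕ n)))

  module DegreeAtLeast2 (2≤deg : 2 ≤ deg β) where

    fromβ : (z : Pt β) {h : List ℕ} → Size h → Carrier (D+ α β)
    fromβ z (finite n)       = inj₂ (finitePoint (suc n) (ω*fromℕ+<ᶜ {n = suc n} 2≤deg))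
    fromβ z (infinite _ _ _) = inj₂ z

    fromβ-key : (z : Pt β) {h : List ℕ} → h ≡ divω (cnf z) → (s : Size h) →
      S.key (fromβ z s) ≡ inj₂ (1+ h)
    fromβ-key z _  (finite n)       = βkey-ω*fromℕ+ n 0
    fromβ-key z eq (infinite _ _ _) = cong (λ h → βkey h mα) (sym eq)

    from : Carrier (D α ⊕ D β) → Carrier (D+ α β)
    from (inj₁ x) = inj₁ x
    from (inj₂ z) = fromβ z (size _ (Normal-divω _ (cnf-Normal z)))

    from-key : ∀ u → S.key (from u) ≡ T.key u
    from-key (inj₁ x) = refl
    from-key (inj₂ z) = fromβ-key z refl (size _ (Normal-divω _ (cnf-Normal z)))

    iso : D+ α β ≅ (D α ⊕ D β)
    iso = ≅-by-keys S shifted-target to from to-key from-key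

  module DegreeBelow2 (β≢0 : Nonzero β) (deg<2 : deg β < 2) where
    open FinitelyManyClasses β β≢0 deg<2

    below-top : ∀ u → S.key u <ᴷ inj₂ (fromℕ (suc top))
    below-top (inj₁ _) = ₁∼₂
    below-top (inj₂ y) = βkey<inj₂ (divω (cnf y)) mα (divω<top+1 y)

    source : Keying (D+ α β ⊕ One) _<ᴷ_
    source = ⊕One-keying S (⊎-<-asymmetric <ᶜ-asym <ᶜ-asym) (inj₂ (fromℕ (suc top))) below-top

    private
      module S′ = Keying source

    to′ : Carrier (D+ α β ⊕ One) → Carrier (D α ⊕ D β)
    to′ (inj₁ u) = to u
    to′ (inj₂ _) = inj₂ (finitePoint top (≤top⇒∈β ≤-refl))

    to′-key : ∀ u → T.key (to′ u) ≡ S′.key u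
    to′-key (inj₁ u) = to-key u
    to′-key (inj₂ _) = cong inj₂ (1+-divω-ω*fromℕ+ top 0)

    fromβ : (z : Pt β) {h : List ℕ} → h <ᶜ fromℕ (suc top) → Size h → Carrier (D+ α β ⊕ One)
    fromβ z h<t (finite n) with m<1+n⇒m<n∨m≡n (fromℕ-<ᶜ⁻ h<t)
    ... | inj₁ n<t = inj₁ (inj₂ (finitePoint (suc n) (≤top⇒∈β n<t)))
    ... | inj₂ _   = inj₂ tt
    fromβ z _   (infinite _ _ _) = inj₁ (inj₂ z)

    fromβ-key : (z : Pt β) {h : List ℕ} → h ≡ divω (cnf z) →
      (h<t : h <ᶜ fromℕ (suc top)) (s : Size h) →
      S′.key (fromβ z h<t s) ≡ inj₂ (1+ h)
    fromβ-key z _ h<t (finite n) with m<1+n⇒m<n∨m≡n (fromℕ-<ᶜ⁻ h<t)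
    ... | inj₁ _    = βkey-ω*fromℕ+ n 0
    ... | inj₂ refl = cong inj₂ (sym (1+-fromℕ top))
    fromβ-key z eq _ (infinite _ _ _) = cong (λ h → βkey h mα) (sym eq)

    from : Carrier (D α ⊕ D β) → Carrier (D+ α β ⊕ One)
    from (inj₁ x) = inj₁ (inj₁ x)
    from (inj₂ z) = fromβ z (divω<top+1 z) (size _ (Normal-divω _ (cnf-Normal z)))

    from-key : ∀ u → S′.key (from u) ≡ T.key u
    from-key (inj₁ x) = refl
    from-key (inj₂ z) = fromβ-key z refl (divω<top+1 z) (size _ (Normal-divω _ (cnf-Normal z)))

    iso : (D+ α β ⊕ One) ≅ (D α ⊕ D β)
    iso = ≅-by-keys source shifted-target to′ from to′-key from-key

mainTheorem9 : (α β : CNF) → Nonzero α → Nonzero β →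
    ((IsLimit α ⊎ (IsSucc α × 2 ≤ deg β)) → D+ α β ≅ (D α ⊕ D β))
    × ((IsSucc α × deg β < 2) → (D+ α β ⊕ One) ≅ (D α ⊕ D β))
mainTheorem9 α β _ β≢0 = limit-or-infinite , successor-finite
  where
  -- α ≠ 0 is unused: it follows from IsLimit α as well as from IsSucc α.
  limit-or-infinite : IsLimit α ⊎ (IsSucc α × 2 ≤ deg β) → D+ α β ≅ (D α ⊕ D β)
  limit-or-infinite (inj₁ (_ , ¬succ)) =
    limit-iso α β (n≤0⇒n≡0 (≮⇒≥ (¬succ ∘ 0<modω⇒IsSucc α)))
  limit-or-infinite (inj₂ (succ , 2≤deg)) =
    Successor.DegreeAtLeast2.iso α β (IsSucc⇒0<modω α succ) 2≤deg

  successor-finite : IsSucc α × deg β < 2 → (D+ α β ⊕ One) ≅ (D α ⊕ D β)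
  successor-finite (succ , deg<2) = Successor.DegreeBelow2.iso α β (IsSucc⇒0<modω α succ) β≢0 deg<2
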